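{- Let $N,f\ge0$ and $m\in\mathcal{M}_{N,f}$, and let $k$ be the number of unstable chords of $m$. Then $\mathrm{core}(m)\in\mathcal{M}_{N-2k,f}$ with $\mathrm{Short}(\mathrm{core}(m))=\emptyset$, and the two-row array $T(m)$ is a standard Young tableau of shape $(N-k,k)$. Consequently the map $F(m)=(\mathrm{core}(m),T(m))$ is a well-defined function from $\mathcal{M}_{N,f}$ to $\bigcup_{k=0}^{n}\{m_0\in\mathcal{M}_{N-2k,f}\mid\mathrm{Short}(m_0)=\emptyset\}\times\mathrm{SYT}(N-k,k)$, where $n=\lfloor (N-f)/2\rfloor$.
   Context: A matching on a finite set $S\subseteq\mathbb{N}$ is a partition of $S$ into blocks of size 1 (unmatched vertices) or 2 (chords $(i,j)$); $\mathcal{M}_{N,f}$ is the set of matchings on $[N]$ with exactly $f$ unmatched vertices; $\mathrm{Short}(m)=\{i\in[N-1]\mid (i,i+1)\text{ is a chord of }m\}$. The reduction process of $m$ repeatedly deletes a chord whose two endpoints are consecutive among the currently remaining vertices, until none remains; deleted chords are unstable (independent of choices). The remaining vertices relabeled $1,2,\dots$ in increasing order form $\mathrm{core}(m)$. $T(m)$ is the array with two rows, the second row being $\{j\mid (i,j)\text{ is an unstable chord of }m,\ i<j\}$ in increasing order and the first row the remaining elements of $[N]$ in increasing order. $\mathrm{SYT}(\lambda)$ denotes standard Young tableaux of shape $\lambda$. -}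

module Defs where

open import Data.Nat using (ℕ; zero; suc; _<_; _≥_; _⊔_)
import Data.Nat as ℕ
open import Data.Fin using (Fin; toℕ) renaming (zero to fzero; suc to fsuc)
import Data.Fin as F
open import Data.List using (List; []; _∷_; length; filter; allFin; map; upTo; concat; lookup)
open import Data.Nat.ListAction using (sum)
open import Data.List.Relation.Unary.All using (All)
open import Data.List.Relation.Unary.Linked using (Linked)
open import Data.List.Relation.Binary.Permutation.Propositional using (_↭_)
open import Data.List.Membership.DecPropositional ℕ._≟_ using (_∈?_)
open import Data.Maybe using (Maybe; just; nothing; fromMaybe)
import Data.Maybe as Maybe
open import Data.Product using (Σ; _×_; _,_; proj₁; proj₂)
open import Relation.Nullary using (¬_; yes; no; ¬?)
open import Relation.Binary.PropositionalEquality using (_≡_)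

-- Vertices 1..N are represented by Fin N (vertex i+1
-- is the element i).  A matching is encoded by its partner function σ:
-- a chord (i,j) means σ i = j and σ j = i (i ≠ j); an unmatched vertex is
-- a fixed point of σ.

IsMatching : {N : ℕ} → (Fin N → Fin N) → Set
IsMatching σ = ∀ i → σ (σ i) ≡ i

unmatched : {N : ℕ} → (Fin N → Fin N) → ℕ
unmatched {N} σ = length (filter (λ i → σ i F.≟ i) (allFin N))

InM : (N f : ℕ) → (Fin N → Fin N) → Set
InM N f σ = IsMatching σ × unmatched σ ≡ f

InShort : {N : ℕ} → (Fin N → Fin N) → Fin N → Set
InShort {N} σ i = Σ (Fin N) λ j → toℕ j ≡ suc (toℕ i) × σ i ≡ j

ShortEmpty : {N : ℕ} → (Fin N → Fin N) → Set
ShortEmpty σ = ∀ i → ¬ InShort σ i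

-- The list of currently remaining vertices is kept in
-- increasing order.  One step deletes the leftmost chord whose endpoints
-- are consecutive among the remaining vertices (by the paper the set of
-- deleted chords does not depend on the choices made).

reduceStep' : {N : ℕ} → (Fin N → Fin N) → Fin N → List (Fin N) →
              Maybe ((Fin N × Fin N) × List (Fin N))
reduceStep' σ x [] = nothing
reduceStep' σ x (y ∷ r) with σ x F.≟ y
... | yes _ = just ((x , y) , r)
... | no _ = Maybe.map (λ p → proj₁ p , x ∷ proj₂ p) (reduceStep' σ y r)

reduceStep : {N : ℕ} → (Fin N → Fin N) → List (Fin N) →
             Maybe ((Fin N × Fin N) × List (Fin N))
reduceStep σ [] = nothing
reduceStep σ (x ∷ r) = reduceStep' σ x r

reduceFuel : {N : ℕ} → ℕ → (Fin N → Fin N) → List (Fin N) →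
             List (Fin N × Fin N) × List (Fin N)
reduceFuel zero σ l = [] , l
reduceFuel (suc n) σ l with reduceStep σ l
... | nothing = [] , l
... | just (c , r) with reduceFuel n σ r
...   | (cs , rem) = c ∷ cs , rem

-- full reduction of σ on [N]; fuel N is enough (each step deletes two vertices)
reduction : {N : ℕ} → (Fin N → Fin N) → List (Fin N × Fin N) × List (Fin N)
reduction {N} σ = reduceFuel N σ (allFin N)

unstable : {N : ℕ} → (Fin N → Fin N) → List (Fin N × Fin N)
unstable σ = proj₁ (reduction σ)

numUnstable : {N : ℕ} → (Fin N → Fin N) → ℕ
numUnstable σ = length (unstable σ)

remaining : {N : ℕ} → (Fin N → Fin N) → List (Fin N)
remaining σ = proj₂ (reduction σ)

indexOf : {N : ℕ} → Fin N → (l : List (Fin N)) → Maybe (Fin (length l))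
indexOf x [] = nothing
indexOf x (y ∷ l) with x F.≟ y
... | yes _ = just fzero
... | no _ = Maybe.map fsuc (indexOf x l)

coreSize : {N : ℕ} → (Fin N → Fin N) → ℕ
coreSize σ = length (remaining σ)

-- partner function of core(σ) (a vertex whose partner were not remaining
-- would be sent to itself; the theorem asserts this yields a matching)
core : {N : ℕ} → (σ : Fin N → Fin N) → Fin (coreSize σ) → Fin (coreSize σ)
core σ p = fromMaybe p (indexOf (σ (lookup (remaining σ) p)) (remaining σ))

_‼_ : {A : Set} → List A → ℕ → Maybe A
[] ‼ n = nothing
(x ∷ xs) ‼ zero = just x
(x ∷ xs) ‼ suc n = xs ‼ n

-- entry of t in row r, column c (0-based) equals a
Entry : List (List ℕ) → ℕ → ℕ → ℕ → Set
Entry t r c a = Maybe.maybe (λ row → row ‼ c) nothing (t ‼ r) ≡ just a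

IsPartition : List ℕ → Set
IsPartition λs = Linked _≥_ λs

record IsSYT (λs : List ℕ) (t : List (List ℕ)) : Set where
  field
    partition : IsPartition λs
    shape     : map length t ≡ λs
    entries   : concat t ↭ map suc (upTo (sum λs))
    rows      : All (Linked _<_) t
    columns   : ∀ r c a b → Entry t r c a → Entry t (suc r) c b → a < b

largerEnds : {N : ℕ} → (Fin N → Fin N) → List ℕ
largerEnds σ = map (λ c → toℕ (proj₁ c) ⊔ toℕ (proj₂ c)) (unstable σ)

T : {N : ℕ} → (Fin N → Fin N) → List (List ℕ)
T {N} σ =
  map suc (filter (λ j → ¬? (j ∈? largerEnds σ)) (upTo N)) ∷
  map suc (filter (λ j → j ∈? largerEnds σ) (upTo N)) ∷ []

-- Each reduction step deletes a chord σ a = b between two vertices that are adjacent among the remaining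
-- ones, so [N] splits into the endpoints of the k unstable chords and the remaining vertices. The remaining
-- vertices are closed under σ (the chord endpoints are), contain every fixed point, and no two adjacent ones
-- form a chord when the process stops; relabelled, they give a matching core(σ) on N − 2k vertices with f
-- unmatched vertices and no short chord. For T(σ), pair each larger endpoint of an unstable chord with its
-- smaller endpoint: below any m there are at least as many smaller endpoints as larger ones, and the smaller
-- endpoints lie in the first row. This ballot condition forces the c-th entry of the first row to be
-- smaller than the c-th entry of the second, so T(σ) is standard.
module Submission where

open import Defs
open import Data.Nat using (ℕ; zero; suc; _+_; _*_; _∸_; _/_; _≤_; _<_; _⊔_; _⊓_; z≤n; s≤s)
open import Data.Nat.Properties
open import Data.Nat.DivMod using (m*n/n≡m; /-monoˡ-≤)
open import Data.Fin as F using (Fin; toℕ) renaming (zero to fzero; suc to fsuc)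
import Data.Fin.Properties as FinP
open import Data.List using (List; []; _∷_; length; filter; map; upTo; _++_; lookup; tabulate; allFin)
import Data.List.Properties as List
open import Data.List.Relation.Unary.All as All using (All; []; _∷_)
import Data.List.Relation.Unary.All.Properties as All
open import Data.List.Relation.Unary.Any using (here; there)
open import Data.List.Relation.Unary.AllPairs using ([]; _∷_)
open import Data.List.Relation.Unary.Unique.Propositional using (Unique)
import Data.List.Relation.Unary.Unique.Propositional.Properties as Unique
open import Data.List.Relation.Unary.Linked using (Linked; []; [-]; _∷_)
import Data.List.Relation.Unary.Linked as Linked
import Data.List.Relation.Unary.Linked.Properties as Linkedₚ
open import Data.List.Relation.Binary.Permutation.Propositional
  using (_↭_; ↭-refl; ↭-sym; ↭-trans; prep; swap; ↭⇒↭ₛ)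
import Data.List.Relation.Binary.Permutation.Propositional.Properties as Perm
import Data.List.Relation.Binary.Permutation.Setoid.Properties as Permₛ
open import Data.List.Relation.Binary.Disjoint.Propositional using (Disjoint)
open import Data.List.Relation.Binary.Sublist.Propositional using (⊆-refl)
open import Data.List.Relation.Binary.Sublist.Heterogeneous.Properties using (length-mono-≤; ⊆-filter-Sublist)
open import Data.List.Membership.Propositional using (_∈_; _∉_)
import Data.List.Membership.Propositional.Properties as Membership
open import Data.List.Membership.DecPropositional _≟_ using (_∈?_)
import Data.Maybe as Maybe
open import Data.Maybe using (just; nothing)
open import Data.Product using (Σ; _×_; _,_; proj₁; proj₂)
open import Data.Sum using (_⊎_; inj₁; inj₂)
open import Data.Empty using (⊥-elim)
open import Function using (id; _∘_)
open import Relation.Nullary using (¬_; yes; no)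
open import Relation.Unary using (Pred; Decidable; ∁)
open import Relation.Unary.Properties using (∁?)
open import Relation.Binary using (tri<; tri≈; tri>)
open import Relation.Binary.PropositionalEquality
  using (_≡_; _≢_; refl; sym; trans; cong; cong₂; subst; subst₂; setoid; module ≡-Reasoning)

count : ∀ {a p} {A : Set a} {P : Pred A p} → Decidable P → List A → ℕ
count P? xs = length (filter P? xs)

module _ {a p} {A : Set a} {P : Pred A p} (P? : Decidable P) where

  count-accept : ∀ {x} xs → P x → count P? (x ∷ xs) ≡ suc (count P? xs)
  count-accept xs px = cong length (List.filter-accept P? px)

  count-reject : ∀ {x} xs → ¬ P x → count P? (x ∷ xs) ≡ count P? xs
  count-reject xs ¬px = cong length (List.filter-reject P? ¬px)

  count-++ : ∀ xs ys → count P? (xs ++ ys) ≡ count P? xs + count P? ys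
  count-++ xs ys = trans (cong length (List.filter-++ P? xs ys)) (List.length-++ (filter P? xs))

  count-↭ : ∀ {xs ys} → xs ↭ ys → count P? xs ≡ count P? ys
  count-↭ p = Perm.↭-length (Perm.filter-↭ P? p)

  count-none : ∀ {xs} → All (∁ P) xs → count P? xs ≡ 0
  count-none ¬pxs = cong length (List.filter-none P? ¬pxs)

  count-all : ∀ {xs} → All P xs → count P? xs ≡ length xs
  count-all pxs = cong length (List.filter-all P? pxs)

  count-map : ∀ {b} {B : Set b} (f : B → A) xs → count (P? ∘ f) xs ≡ count P? (map f xs)
  count-map f [] = refl
  count-map f (x ∷ xs) with P? (f x)
  ... | yes _ = cong suc (count-map f xs)
  ... | no _ = count-map f xs

  filter-∁-++-filter-↭ : ∀ xs → filter (∁? P?) xs ++ filter P? xs ↭ xs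
  filter-∁-++-filter-↭ [] = ↭-refl
  filter-∁-++-filter-↭ (x ∷ xs) with P? x
  ... | yes _ = ↭-trans (Perm.shift x (filter (∁? P?) xs) (filter P? xs)) (prep x (filter-∁-++-filter-↭ xs))
  ... | no _ = prep x (filter-∁-++-filter-↭ xs)

  count-∁-+-count : ∀ xs → count (∁? P?) xs + count P? xs ≡ length xs
  count-∁-+-count xs =
    trans (sym (List.length-++ (filter (∁? P?) xs))) (Perm.↭-length (filter-∁-++-filter-↭ xs))

count-mono : ∀ {a p q} {A : Set a} {P : Pred A p} {Q : Pred A q} (P? : Decidable P) (Q? : Decidable Q) →
             (∀ {x} → P x → Q x) → ∀ xs → count P? xs ≤ count Q? xs
count-mono P? Q? P⇒Q xs = length-mono-≤ (⊆-filter-Sublist P? Q? {as = xs} (λ { refl → P⇒Q }) ⊆-refl)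

Unique-resp-↭ : ∀ {A : Set} {xs ys : List A} → xs ↭ ys → Unique xs → Unique ys
Unique-resp-↭ {A} p = Permₛ.Unique-resp-↭ (setoid A) (↭⇒↭ₛ p)

Unique-++⁻ : ∀ {A : Set} (xs : List A) {ys} → Unique (xs ++ ys) → Unique xs × Unique ys × Disjoint xs ys
Unique-++⁻ [] ys! = [] , ys! , λ ()
Unique-++⁻ (x ∷ xs) (x∉ ∷ xs++ys!) with Unique-++⁻ xs xs++ys!
... | xs! , ys! , xs#ys = All.++⁻ˡ xs x∉ ∷ xs! , ys! , λ where
  (here refl , v∈ys) → All.lookup (All.++⁻ʳ xs x∉) v∈ys refl
  (there v∈xs , v∈ys) → xs#ys (v∈xs , v∈ys)

lookup-injective : ∀ {A : Set} {xs : List A} → Unique xs → ∀ {i j} → lookup xs i ≡ lookup xs j → i ≡ j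
lookup-injective {xs = _ ∷ _} _ {fzero} {fzero} _ = refl
lookup-injective {xs = _ ∷ _} (x∉ ∷ _) {fzero} {fsuc j} x≡xⱼ =
  ⊥-elim (All.lookup x∉ (Membership.∈-lookup j) x≡xⱼ)
lookup-injective {xs = _ ∷ _} (x∉ ∷ _) {fsuc i} {fzero} xᵢ≡x =
  ⊥-elim (All.lookup x∉ (Membership.∈-lookup i) (sym xᵢ≡x))
lookup-injective {xs = _ ∷ _} (_ ∷ xs!) {fsuc i} {fsuc j} xᵢ≡xⱼ = cong fsuc (lookup-injective xs! xᵢ≡xⱼ)

Linked-lookup : ∀ {A : Set} {R : A → A → Set} {xs} → Linked R xs →
                ∀ {i j : Fin (length xs)} → toℕ j ≡ suc (toℕ i) → R (lookup xs i) (lookup xs j)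
Linked-lookup (r ∷ _) {fzero} {fsuc fzero} _ = r
Linked-lookup (_ ∷ rs) {fsuc i} {fsuc j} j≡1+i = Linked-lookup rs (suc-injective j≡1+i)

‼-++⁻ : ∀ {A : Set} (xs ys : List A) c {a} → (xs ++ ys) ‼ c ≡ just a →
        xs ‼ c ≡ just a ⊎ (length xs ≤ c × ys ‼ (c ∸ length xs) ≡ just a)
‼-++⁻ [] ys c e = inj₂ (z≤n , e)
‼-++⁻ (x ∷ xs) ys zero e = inj₁ e
‼-++⁻ (x ∷ xs) ys (suc c) e with ‼-++⁻ xs ys c e
... | inj₁ e′ = inj₁ e′
... | inj₂ (len≤c , e′) = inj₂ (s≤s len≤c , e′)

‼-singleton : ∀ {A : Set} {x a : A} d → (x ∷ []) ‼ d ≡ just a → x ≡ a × d ≡ 0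
‼-singleton zero refl = refl , refl

‼-map⁻ : ∀ {A B : Set} (f : A → B) xs c {b} → map f xs ‼ c ≡ just b →
         Σ A λ a → f a ≡ b × xs ‼ c ≡ just a
‼-map⁻ f (x ∷ xs) zero refl = x , refl , refl
‼-map⁻ f (x ∷ xs) (suc c) e = ‼-map⁻ f xs c e

module _ {p} {P : Pred ℕ p} (P? : Decidable P) where

  count-upTo-suc : ∀ n → count P? (upTo (suc n)) ≡ count P? (upTo n) + count P? (n ∷ [])
  count-upTo-suc n = trans (cong (count P?) (sym (List.upTo-∷ʳ n))) (count-++ P? (upTo n) (n ∷ []))

  count-upTo-suc-accept : ∀ n → P n → count P? (upTo (suc n)) ≡ suc (count P? (upTo n))
  count-upTo-suc-accept n pn =
    trans (count-upTo-suc n) (trans (cong (count P? (upTo n) +_) (count-accept P? [] pn)) (+-comm _ 1))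

  count-upTo-suc-reject : ∀ n → ¬ P n → count P? (upTo (suc n)) ≡ count P? (upTo n)
  count-upTo-suc-reject n ¬pn =
    trans (count-upTo-suc n) (trans (cong (count P? (upTo n) +_) (count-reject P? [] ¬pn)) (+-identityʳ _))

  count-upTo-mono : ∀ {m n} → m ≤ n → count P? (upTo m) ≤ count P? (upTo n)
  count-upTo-mono {n = zero} z≤n = ≤-refl
  count-upTo-mono {n = suc n} m≤1+n with m≤n⇒m<n∨m≡n m≤1+n
  ... | inj₂ refl = ≤-refl
  ... | inj₁ (s≤s m≤n) =
    ≤-trans (count-upTo-mono m≤n) (subst (count P? (upTo n) ≤_) (sym (count-upTo-suc n)) (m≤m+n _ _))

  filter-upTo-suc : ∀ n → filter P? (upTo (suc n)) ≡ filter P? (upTo n) ++ filter P? (n ∷ [])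
  filter-upTo-suc n = trans (cong (filter P?) (sym (List.upTo-∷ʳ n))) (List.filter-++ P? (upTo n) (n ∷ []))

  lookup-filter-upTo : ∀ n c {a} → filter P? (upTo n) ‼ c ≡ just a → P a × count P? (upTo a) ≡ c
  lookup-filter-upTo (suc n) c e
    with ‼-++⁻ (filter P? (upTo n)) (filter P? (n ∷ [])) c (subst (λ l → l ‼ c ≡ just _) (filter-upTo-suc n) e)
  ... | inj₁ e′ = lookup-filter-upTo n c e′
  ... | inj₂ (len≤c , e′) with P? n
  ...   | yes pn with ‼-singleton (c ∸ count P? (upTo n)) e′
  ...     | refl , c∸len≡0 = pn , ≤-antisym len≤c (m∸n≡0⇒m≤n c∸len≡0)

count-<-suc : ∀ m xs → count (_<? suc m) xs ≡ count (_<? m) xs + count (_≟ m) xs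
count-<-suc m [] = refl
count-<-suc m (x ∷ xs) with <-cmp x m
... | tri< x<m x≢m _
  rewrite count-accept (_<? suc m) xs (m<n⇒m<1+n x<m) | count-accept (_<? m) xs x<m | count-reject (_≟ m) xs x≢m
  = cong suc (count-<-suc m xs)
... | tri≈ x≮m refl _
  rewrite count-accept (_<? suc x) xs ≤-refl | count-reject (_<? x) xs x≮m | count-accept (_≟ x) xs refl
  = trans (cong suc (count-<-suc x xs)) (sym (+-suc _ _))
... | tri> x≮m x≢m m<x
  rewrite count-reject (_<? suc m) xs (<⇒≱ (s≤s m<x)) | count-reject (_<? m) xs x≮m | count-reject (_≟ m) xs x≢m
  = count-<-suc m xs

count-≟-∉ : ∀ {m xs} → m ∉ xs → count (_≟ m) xs ≡ 0
count-≟-∉ {m} m∉xs = count-none (_≟ m) (All.tabulate λ x∈xs x≡m → m∉xs (subst (_∈ _) x≡m x∈xs))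

count-≟-∈ : ∀ {m xs} → Unique xs → m ∈ xs → count (_≟ m) xs ≡ 1
count-≟-∈ {xs = x ∷ xs} (x∉xs ∷ _) (here refl) =
  trans (count-accept (_≟ x) xs refl) (cong suc (count-≟-∉ λ x∈xs → All.lookup x∉xs x∈xs refl))
count-≟-∈ {m} {x ∷ xs} (x∉xs ∷ xs!) (there m∈xs) =
  trans (count-reject (_≟ m) xs (All.lookup x∉xs m∈xs)) (count-≟-∈ xs! m∈xs)

count-≟-unique : ∀ {xs} → Unique xs → ∀ m → count (_≟ m) xs ≡ count (_∈? xs) (m ∷ [])
count-≟-unique {xs} xs! m with m ∈? xs
... | yes m∈xs = count-≟-∈ xs! m∈xs
... | no m∉xs = count-≟-∉ m∉xs

count-∈-upTo : ∀ {xs} → Unique xs → ∀ m → count (_∈? xs) (upTo m) ≡ count (_<? m) xs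
count-∈-upTo {xs} xs! zero = sym (count-none (_<? 0) (All.universal (λ _ ()) xs))
count-∈-upTo {xs} xs! (suc m) = begin
  count (_∈? xs) (upTo (suc m))                       ≡⟨ count-upTo-suc (_∈? xs) m ⟩
  count (_∈? xs) (upTo m) + count (_∈? xs) (m ∷ [])   ≡⟨ cong₂ _+_ (count-∈-upTo xs! m) (sym (count-≟-unique xs! m)) ⟩
  count (_<? m) xs + count (_≟ m) xs                  ≡⟨ sym (count-<-suc m xs) ⟩
  count (_<? suc m) xs                                ∎
  where open ≡-Reasoning

Ballot : List ℕ → Set
Ballot A = ∀ m → count (_∈? A) (upTo m) ≤ count (∁? (_∈? A)) (upTo m)

twoRowTableau : ℕ → List ℕ → List (List ℕ)
twoRowTableau N A = map suc (filter (∁? (_∈? A)) (upTo N)) ∷ map suc (filter (_∈? A) (upTo N)) ∷ []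

module _ {A : List ℕ} (ballot : Ballot A) where

  -- If b ≤ a, the prefix [0, b] would contain c + 1 elements of A but only c elements outside A.
  ballot⇒lookup-< : ∀ N c {a b} → filter (∁? (_∈? A)) (upTo N) ‼ c ≡ just a →
                    filter (_∈? A) (upTo N) ‼ c ≡ just b → a < b
  ballot⇒lookup-< N c {a} {b} a-at-c b-at-c with a <? b
  ... | yes a<b = a<b
  ... | no a≮b = ⊥-elim (1+n≰n (begin
    suc c                                   ≡⟨ cong suc (sym count-A-below-b) ⟩
    suc (count (_∈? A) (upTo b))            ≡⟨ sym (count-upTo-suc-accept (_∈? A) b b∈A) ⟩
    count (_∈? A) (upTo (suc b))            ≤⟨ ballot (suc b) ⟩
    count (∁? (_∈? A)) (upTo (suc b))       ≡⟨ count-upTo-suc-reject (∁? (_∈? A)) b (λ b∉A → b∉A b∈A) ⟩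
    count (∁? (_∈? A)) (upTo b)             ≤⟨ count-upTo-mono (∁? (_∈? A)) (≮⇒≥ a≮b) ⟩
    count (∁? (_∈? A)) (upTo a)             ≡⟨ count-∁A-below-a ⟩
    c                                       ∎))
    where
    open ≤-Reasoning
    count-∁A-below-a = proj₂ (lookup-filter-upTo (∁? (_∈? A)) N c a-at-c)
    b∈A = proj₁ (lookup-filter-upTo (_∈? A) N c b-at-c)
    count-A-below-b = proj₂ (lookup-filter-upTo (_∈? A) N c b-at-c)

  ballot⇒columns : ∀ N r c a b → Entry (twoRowTableau N A) r c a → Entry (twoRowTableau N A) (suc r) c b → a < b
  ballot⇒columns N zero c a b a-at-c b-at-c
    with ‼-map⁻ suc (filter (∁? (_∈? A)) (upTo N)) c a-at-c | ‼-map⁻ suc (filter (_∈? A) (upTo N)) c b-at-c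
  ... | a′ , refl , a′-at-c | b′ , refl , b′-at-c = s≤s (ballot⇒lookup-< N c a′-at-c b′-at-c)

increasing-filter-upTo : ∀ {p} {P : Pred ℕ p} (P? : Decidable P) N → Linked _<_ (map suc (filter P? (upTo N)))
increasing-filter-upTo P? N =
  Linkedₚ.map⁺ (Linked.map s≤s (Linkedₚ.filter⁺ P? <-trans (Linkedₚ.applyUpTo⁺₂ id N (λ i → n<1+n i))))

twoRowTableau-isSYT : ∀ N {A} → Unique A → All (_< N) A → Ballot A →
                      IsSYT (N ∸ length A ∷ length A ∷ []) (twoRowTableau N A)
twoRowTableau-isSYT N {A} A! A<N ballot = record
  { partition = k≤N∸k ∷ [-]
  ; shape     = cong₂ (λ a b → a ∷ b ∷ [])
                  (trans (List.length-map suc (filter (∁? (_∈? A)) (upTo N))) count-∁A)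
                  (trans (List.length-map suc (filter (_∈? A) (upTo N))) count-A)
  ; entries   = entries
  ; rows      = increasing-filter-upTo (∁? (_∈? A)) N ∷ increasing-filter-upTo (_∈? A) N ∷ []
  ; columns   = ballot⇒columns ballot N
  }
  where
  k = length A
  count-A : count (_∈? A) (upTo N) ≡ k
  count-A = trans (count-∈-upTo A! N) (count-all (_<? N) A<N)
  count-∁A+k : count (∁? (_∈? A)) (upTo N) + k ≡ N
  count-∁A+k = trans (cong (count (∁? (_∈? A)) (upTo N) +_) (sym count-A))
                     (trans (count-∁-+-count (_∈? A) (upTo N)) (List.length-upTo N))
  count-∁A : count (∁? (_∈? A)) (upTo N) ≡ N ∸ k
  count-∁A = trans (sym (m+n∸n≡m _ k)) (cong (_∸ k) count-∁A+k)
  k≤N∸k : k ≤ N ∸ k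
  k≤N∸k = subst₂ _≤_ count-A count-∁A (ballot N)
  N∸k+k≡N : N ∸ k + (k + 0) ≡ N
  N∸k+k≡N = trans (cong (N ∸ k +_) (+-identityʳ k)) (trans (cong (_+ k) (sym count-∁A)) count-∁A+k)
  entries : map suc (filter (∁? (_∈? A)) (upTo N)) ++ map suc (filter (_∈? A) (upTo N)) ++ []
            ↭ map suc (upTo (N ∸ k + (k + 0)))
  entries rewrite N∸k+k≡N | List.++-identityʳ (map suc (filter (_∈? A) (upTo N)))
                | sym (List.map-++ suc (filter (∁? (_∈? A)) (upTo N)) (filter (_∈? A) (upTo N)))
    = Perm.map⁺ suc (filter-∁-++-filter-↭ (_∈? A) (upTo N))

ballot-of-pairs : ∀ {X : Set} (lo hi : X → ℕ) → (∀ x → lo x ≤ hi x) →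
                  ∀ xs → Unique (map lo xs ++ map hi xs) → Ballot (map hi xs)
ballot-of-pairs lo hi lo≤hi xs lo++hi! m = begin
  count (_∈? H) (upTo m)          ≡⟨ count-∈-upTo H! m ⟩
  count (_<? m) H                 ≡⟨ sym (count-map (_<? m) hi xs) ⟩
  count ((_<? m) ∘ hi) xs         ≤⟨ count-mono _ _ (λ {x} → ≤-<-trans (lo≤hi x)) xs ⟩
  count ((_<? m) ∘ lo) xs         ≡⟨ count-map (_<? m) lo xs ⟩
  count (_<? m) L                 ≡⟨ sym (count-∈-upTo L! m) ⟩
  count (_∈? L) (upTo m)          ≤⟨ count-mono (_∈? L) (∁? (_∈? H)) (λ v∈L v∈H → L#H (v∈L , v∈H)) (upTo m) ⟩
  count (∁? (_∈? H)) (upTo m)     ∎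
  where
  open ≤-Reasoning
  L = map lo xs
  H = map hi xs
  L! = proj₁ (Unique-++⁻ L lo++hi!)
  H! = proj₁ (proj₂ (Unique-++⁻ L lo++hi!))
  L#H = proj₂ (proj₂ (Unique-++⁻ L lo++hi!))

endpoints : ∀ {A : Set} → List (A × A) → List A
endpoints [] = []
endpoints ((x , y) ∷ cs) = x ∷ y ∷ endpoints cs

length-endpoints : ∀ {A : Set} (cs : List (A × A)) → length (endpoints cs) ≡ 2 * length cs
length-endpoints [] = refl
length-endpoints (c ∷ cs) = trans (cong (suc ∘ suc) (length-endpoints cs)) (sym (*-suc 2 (length cs)))

↭-min-max : ∀ m n {xs} → m ∷ n ∷ xs ↭ m ⊓ n ∷ m ⊔ n ∷ xs
↭-min-max m n with ≤-total m n
... | inj₁ m≤n rewrite m≤n⇒m⊓n≡m m≤n | m≤n⇒m⊔n≡n m≤n = ↭-refl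
... | inj₂ n≤m rewrite m≥n⇒m⊓n≡n n≤m | m≥n⇒m⊔n≡m n≤m = swap m n ↭-refl

module _ {N : ℕ} where

  lower upper : Fin N × Fin N → ℕ
  lower (x , y) = toℕ x ⊓ toℕ y
  upper (x , y) = toℕ x ⊔ toℕ y

  lower≤upper : ∀ c → lower c ≤ upper c
  lower≤upper (x , y) = m⊓n≤m⊔n (toℕ x) (toℕ y)

  upper<N : ∀ c → upper c < N
  upper<N (x , y) = ⊔-lub (FinP.toℕ<n x) (FinP.toℕ<n y)

  endpoints-↭-lower++upper : ∀ cs → map toℕ (endpoints cs) ↭ map lower cs ++ map upper cs
  endpoints-↭-lower++upper [] = ↭-refl
  endpoints-↭-lower++upper (c@(x , y) ∷ cs) =
    ↭-trans (↭-min-max (toℕ x) (toℕ y))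
            (prep (lower c) (↭-trans (prep (upper c) (endpoints-↭-lower++upper cs))
                                     (↭-sym (Perm.shift (upper c) (map lower cs) (map upper cs)))))

module _ {N : ℕ} (σ : Fin N → Fin N) where

  IsChord : Fin N × Fin N → Set
  IsChord (x , y) = σ x ≡ y

  Reduced : List (Fin N) → Set
  Reduced = Linked (λ x y → σ x ≢ y)

  record IsReduction (l : List (Fin N)) (cs : List (Fin N × Fin N)) (rem : List (Fin N)) : Set where
    field
      partition : l ↭ endpoints cs ++ rem
      chords    : All IsChord cs
      reduced   : Reduced rem

  reduceStep'-just : ∀ x r {c r′} → reduceStep' σ x r ≡ just (c , r′) →
                     IsChord c × x ∷ r ↭ endpoints (c ∷ []) ++ r′
  reduceStep'-just x (y ∷ r) e with σ x F.≟ y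
  reduceStep'-just x (y ∷ r) refl | yes σx≡y = σx≡y , ↭-refl
  ... | no _ with reduceStep' σ y r in e′
  reduceStep'-just x (y ∷ r) refl | no _ | just ((a , b) , r′) with reduceStep'-just y r e′
  ... | σa≡b , y∷r↭ab∷r′ =
    σa≡b , ↭-trans (prep x y∷r↭ab∷r′) (↭-sym (Perm.shift x (a ∷ b ∷ []) r′))

  reduceStep'-nothing : ∀ x r → reduceStep' σ x r ≡ nothing → Reduced (x ∷ r)
  reduceStep'-nothing x [] _ = [-]
  reduceStep'-nothing x (y ∷ r) e with σ x F.≟ y
  ... | no σx≢y with reduceStep' σ y r in e′
  ...   | nothing = σx≢y ∷ reduceStep'-nothing y r e′

  reduceFuel-isReduction : ∀ n l → length l ≤ n →
                           IsReduction l (proj₁ (reduceFuel n σ l)) (proj₂ (reduceFuel n σ l))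
  reduceFuel-isReduction zero [] _ = record { partition = ↭-refl ; chords = [] ; reduced = [] }
  reduceFuel-isReduction (suc n) [] _ = record { partition = ↭-refl ; chords = [] ; reduced = [] }
  reduceFuel-isReduction (suc n) (x ∷ r) |x∷r|≤1+n with reduceStep' σ x r in e
  ... | nothing = record { partition = ↭-refl ; chords = [] ; reduced = reduceStep'-nothing x r e }
  ... | just ((a , b) , r′) with reduceStep'-just x r e
  ...   | σa≡b , x∷r↭ab∷r′ with reduceFuel n σ r′ | reduceFuel-isReduction n r′ |r′|≤n
    where
    |r′|≤n : length r′ ≤ n
    |r′|≤n = ≤-trans (n≤1+n _) (≤-pred (subst (_≤ suc n) (Perm.↭-length x∷r↭ab∷r′) |x∷r|≤1+n))
  ...     | cs , rem | r′-reduction = record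
    { partition = ↭-trans x∷r↭ab∷r′ (prep a (prep b (IsReduction.partition r′-reduction)))
    ; chords    = σa≡b ∷ IsReduction.chords r′-reduction
    ; reduced   = IsReduction.reduced r′-reduction
    }

  module _ (σ-involutive : IsMatching σ) where

    σ-endpoints : ∀ {cs} → All IsChord cs → ∀ {z} → z ∈ endpoints cs → σ z ∈ endpoints cs
    σ-endpoints {(x , y) ∷ cs} (σx≡y ∷ _) (here refl) = there (here σx≡y)
    σ-endpoints {(x , y) ∷ cs} (σx≡y ∷ _) (there (here refl)) = here (trans (cong σ (sym σx≡y)) (σ-involutive x))
    σ-endpoints {(x , y) ∷ cs} (_ ∷ cs-chords) (there (there z∈cs)) = there (there (σ-endpoints cs-chords z∈cs))

    endpoints-unfixed : ∀ {cs} → Unique (endpoints cs) → All IsChord cs → All (λ z → σ z ≢ z) (endpoints cs)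
    endpoints-unfixed {[]} _ _ = []
    endpoints-unfixed {(x , y) ∷ cs} ((x≢y ∷ _) ∷ _ ∷ cs!) (σx≡y ∷ cs-chords) =
      (λ σx≡x → x≢y (trans (sym σx≡x) σx≡y)) ∷
      (λ σy≡y → x≢y (trans (sym (σ-involutive x)) (trans (cong σ σx≡y) σy≡y))) ∷
      endpoints-unfixed cs! cs-chords

fixed? : ∀ {n} (τ : Fin n → Fin n) → Decidable (λ z → τ z ≡ z)
fixed? τ z = τ z F.≟ z

indexOf-∈ : ∀ {N} {x : Fin N} l → x ∈ l → Σ (Fin (length l)) λ i → indexOf x l ≡ just i × lookup l i ≡ x
indexOf-∈ {x = x} (y ∷ l) x∈y∷l with x F.≟ y | x∈y∷l
... | yes x≡y | _ = fzero , refl , sym x≡y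
... | no x≢y | here x≡y = ⊥-elim (x≢y x≡y)
... | no _ | there x∈l with indexOf-∈ l x∈l
...   | i , at-i , lookup-i = fsuc i , cong (Maybe.map fsuc) at-i , lookup-i

module _ {N : ℕ} (σ : Fin N → Fin N) where
  private
    cs = unstable σ
    rem = remaining σ

  reduction-isReduction : IsReduction σ (allFin N) (unstable σ) (remaining σ)
  reduction-isReduction = reduceFuel-isReduction σ N (allFin N) (≤-reflexive (List.length-tabulate id))

  open IsReduction reduction-isReduction

  private
    endpoints++rem! : Unique (endpoints cs ++ rem)
    endpoints++rem! = Unique-resp-↭ partition (Unique.allFin⁺ N)
    endpoints! = proj₁ (Unique-++⁻ (endpoints cs) endpoints++rem!)
    rem! = proj₁ (proj₂ (Unique-++⁻ (endpoints cs) endpoints++rem!))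
    endpoints#rem = proj₂ (proj₂ (Unique-++⁻ (endpoints cs) endpoints++rem!))

  N≡2k+coreSize : N ≡ 2 * numUnstable σ + coreSize σ
  N≡2k+coreSize = begin
    N                                   ≡⟨ sym (List.length-tabulate id) ⟩
    length (allFin N)                   ≡⟨ Perm.↭-length partition ⟩
    length (endpoints cs ++ rem)        ≡⟨ List.length-++ (endpoints cs) ⟩
    length (endpoints cs) + length rem  ≡⟨ cong (_+ length rem) (length-endpoints cs) ⟩
    2 * numUnstable σ + coreSize σ      ∎
    where open ≡-Reasoning

  -- By definition T σ is twoRowTableau N (map upper (unstable σ)).
  T-isSYT : IsSYT (N ∸ numUnstable σ ∷ numUnstable σ ∷ []) (T σ)
  T-isSYT = subst (λ k → IsSYT (N ∸ k ∷ k ∷ []) (T σ)) (List.length-map upper cs)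
    (twoRowTableau-isSYT N upper! (All.map⁺ (All.universal upper<N cs))
                         (ballot-of-pairs lower upper lower≤upper cs lower++upper!))
    where
    lower++upper! : Unique (map lower cs ++ map upper cs)
    lower++upper! = Unique-resp-↭ (endpoints-↭-lower++upper cs) (Unique.map⁺ FinP.toℕ-injective endpoints!)
    upper! = proj₁ (proj₂ (Unique-++⁻ (map lower cs) lower++upper!))

  module _ (σ-involutive : IsMatching σ) where

    σ-remaining : ∀ {z} → z ∈ rem → σ z ∈ rem
    σ-remaining {z} z∈rem
      with Membership.∈-++⁻ (endpoints cs) (Perm.∈-resp-↭ partition (Membership.∈-allFin (σ z)))
    ... | inj₂ σz∈rem = σz∈rem
    ... | inj₁ σz∈endpoints = ⊥-elim (endpoints#rem (z∈endpoints , z∈rem))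
      where
      z∈endpoints = subst (_∈ endpoints cs) (σ-involutive z) (σ-endpoints σ σ-involutive chords σz∈endpoints)

    lookup-core : ∀ p → lookup rem (core σ p) ≡ σ (lookup rem p)
    lookup-core p with indexOf-∈ rem (σ-remaining (Membership.∈-lookup p))
    ... | i , index≡i , lookup-i = trans (cong (lookup rem ∘ Maybe.fromMaybe p) index≡i) lookup-i

    core-isMatching : IsMatching (core σ)
    core-isMatching p = lookup-injective rem! (begin
      lookup rem (core σ (core σ p))  ≡⟨ lookup-core (core σ p) ⟩
      σ (lookup rem (core σ p))       ≡⟨ cong σ (lookup-core p) ⟩
      σ (σ (lookup rem p))            ≡⟨ σ-involutive (lookup rem p) ⟩
      lookup rem p                    ∎)
      where open ≡-Reasoning

    core-shortEmpty : ShortEmpty (core σ)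
    core-shortEmpty i (j , j≡1+i , core-i≡j) =
      Linked-lookup reduced j≡1+i (trans (sym (lookup-core i)) (cong (lookup rem) core-i≡j))

    unmatched≡count-fixed-remaining : unmatched σ ≡ count (fixed? σ) rem
    unmatched≡count-fixed-remaining = begin
      count (fixed? σ) (allFin N)                             ≡⟨ count-↭ (fixed? σ) partition ⟩
      count (fixed? σ) (endpoints cs ++ rem)                  ≡⟨ count-++ (fixed? σ) (endpoints cs) rem ⟩
      count (fixed? σ) (endpoints cs) + count (fixed? σ) rem  ≡⟨ cong (_+ count (fixed? σ) rem) no-fixed-endpoint ⟩
      count (fixed? σ) rem                                    ∎
      where
      open ≡-Reasoning
      no-fixed-endpoint = count-none (fixed? σ) (endpoints-unfixed σ σ-involutive endpoints! chords)

    unmatched-core : unmatched (core σ) ≡ unmatched σ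
    unmatched-core = begin
      count (fixed? (core σ)) (allFin n)              ≡⟨ cong length (List.filter-≐ (fixed? (core σ)) (fixed? σ ∘ lookup rem)
                                                                           (core-fixed⇒ , core-fixed⇐) (allFin n)) ⟩
      count (fixed? σ ∘ lookup rem) (allFin n)        ≡⟨ count-map (fixed? σ) (lookup rem) (allFin n) ⟩
      count (fixed? σ) (map (lookup rem) (allFin n))  ≡⟨ cong (count (fixed? σ)) (List.map-tabulate id (lookup rem)) ⟩
      count (fixed? σ) (tabulate (lookup rem))   ≡⟨ cong (count (fixed? σ)) (List.tabulate-lookup rem) ⟩
      count (fixed? σ) rem                            ≡⟨ sym unmatched≡count-fixed-remaining ⟩
      unmatched σ                                     ∎
      where
      open ≡-Reasoning
      n = coreSize σ
      core-fixed⇒ : ∀ {p} → core σ p ≡ p → σ (lookup rem p) ≡ lookup rem p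
      core-fixed⇒ {p} core-p≡p = trans (sym (lookup-core p)) (cong (lookup rem) core-p≡p)
      core-fixed⇐ : ∀ {p} → σ (lookup rem p) ≡ lookup rem p → core σ p ≡ p
      core-fixed⇐ {p} σ-fixes = lookup-injective rem! (trans (lookup-core p) σ-fixes)

    unmatched≤coreSize : unmatched σ ≤ coreSize σ
    unmatched≤coreSize =
      subst (_≤ coreSize σ) (sym unmatched≡count-fixed-remaining) (List.length-filter (fixed? σ) rem)

2*m≤n⇒m≤n/2 : ∀ {m n} → 2 * m ≤ n → m ≤ n / 2
2*m≤n⇒m≤n/2 {m} {n} 2m≤n = subst (_≤ n / 2) (m*n/n≡m m 2) (/-monoˡ-≤ 2 (subst (_≤ n) (*-comm 2 m) 2m≤n))

corollary4p5 : (N f : ℕ) (σ : Fin N → Fin N) → InM N f σ →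
    2 * numUnstable σ ≤ N
    × coreSize σ ≡ N ∸ 2 * numUnstable σ
    × InM (coreSize σ) f (core σ)
    × ShortEmpty (core σ)
    × IsSYT (N ∸ numUnstable σ ∷ numUnstable σ ∷ []) (T σ)
    × numUnstable σ ≤ (N ∸ f) / 2
corollary4p5 N f σ (σ-matching , unmatched≡f) =
  2k≤N , coreSize≡N∸2k , (core-isMatching σ σ-matching , trans (unmatched-core σ σ-matching) unmatched≡f) ,
  core-shortEmpty σ σ-matching , T-isSYT σ , 2*m≤n⇒m≤n/2 2k≤N∸f
  where
  k = numUnstable σ
  2k≤N : 2 * k ≤ N
  2k≤N = subst (2 * k ≤_) (sym (N≡2k+coreSize σ)) (m≤m+n (2 * k) (coreSize σ))
  coreSize≡N∸2k : coreSize σ ≡ N ∸ 2 * k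
  coreSize≡N∸2k = sym (trans (cong (_∸ 2 * k) (N≡2k+coreSize σ)) (m+n∸m≡n (2 * k) (coreSize σ)))
  N∸coreSize≡2k : N ∸ coreSize σ ≡ 2 * k
  N∸coreSize≡2k = trans (cong (_∸ coreSize σ) (N≡2k+coreSize σ)) (m+n∸n≡m (2 * k) (coreSize σ))
  2k≤N∸f : 2 * k ≤ N ∸ f
  2k≤N∸f = subst (_≤ N ∸ f) N∸coreSize≡2k
             (∸-monoʳ-≤ N (subst (_≤ coreSize σ) unmatched≡f (unmatched≤coreSize σ σ-matching)))
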